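{- No isoarithmetic IASI $f$ of a graph $G$ is a strong IASI; that is, there is an edge $uv\in E(G)$ with $|f^+(uv)|\neq |f(u)|\,|f(v)|$.
   Context: All graphs are simple and finite with no isolated vertices (in particular $G$ has at least one edge). Let $\mathbb{N}_0$ be the set of non-negative integers and $\mathcal{P}(\mathbb{N}_0)$ its power set; all label sets are finite and non-empty. For sets $A,B$, $A+B=\{a+b: a\in A, b\in B\}$. An integer additive set-indexer (IASI) of $G$ is an injective map $f:V(G)\to\mathcal{P}(\mathbb{N}_0)$ such that the induced map $f^+:E(G)\to\mathcal{P}(\mathbb{N}_0)$, $f^+(uv)=f(u)+f(v)$, is also injective. A strong IASI is an IASI with $|f^+(uv)|=|f(u)|\,|f(v)|$ for every edge $uv$. An AP-set is a finite set of integers with at least three elements forming an arithmetic progression; its common difference is the deterministic index of the element it labels. An IASI $f$ is arithmetic if $f(v)$ is an AP-set for every vertex $v$ and $f^+(e)$ is an AP-set for every edge $e$. An arithmetic IASI is isoarithmetic if all vertices and edges have the same deterministic index. -}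

module Defs where

open import Data.Nat using (ℕ; _+_; _*_; _≤_; _≟_)
open import Data.Fin using (Fin)
open import Data.List using (List; length; map; upTo; cartesianProductWith; deduplicate)
open import Data.List.Membership.Propositional using (_∈_)
open import Data.Product using (Σ; _×_; ∃; ∃-syntax)
open import Data.Sum using (_⊎_)
open import Relation.Binary.PropositionalEquality using (_≡_)
open import Relation.Nullary using (¬_)
open import Function.Bundles using (_⇔_)

-- Finite subsets of ℕ₀ represented by lists (a list denotes the set of its
-- members; duplicates and order are irrelevant).
FinSet : Set
FinSet = List ℕ

_≈ₛ_ : FinSet → FinSet → Set
A ≈ₛ B = ∀ x → (x ∈ A) ⇔ (x ∈ B)

∣_∣ₛ : FinSet → ℕ
∣ A ∣ₛ = length (deduplicate _≟_ A)

_⊕_ : FinSet → FinSet → FinSet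
A ⊕ B = cartesianProductWith _+_ A B

IsAPWith : ℕ → FinSet → Set
IsAPWith d S = 1 ≤ d × ∃[ a ] ∃[ k ] (3 ≤ k × S ≈ₛ map (λ i → a + i * d) (upTo k))

record Graph : Set₁ where
  field
    n       : ℕ
    Adj     : Fin n → Fin n → Set
    sym     : ∀ {u v} → Adj u v → Adj v u
    irrefl  : ∀ {u} → ¬ Adj u u
    noIsolated : ∀ u → ∃[ v ] Adj u v
    hasEdge : ∃[ u ] ∃[ v ] Adj u v

module _ (G : Graph) where
  open Graph G

  edgeLabel : (Fin n → FinSet) → Fin n → Fin n → FinSet
  edgeLabel f u v = f u ⊕ f v

  record IsIASI (f : Fin n → FinSet) : Set where
    field
      nonEmpty  : ∀ v → 1 ≤ ∣ f v ∣ₛ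
      injective : ∀ u v → f u ≈ₛ f v → u ≡ v
      edgeInjective : ∀ u v x y → Adj u v → Adj x y →
        edgeLabel f u v ≈ₛ edgeLabel f x y →
        (u ≡ x × v ≡ y) ⊎ (u ≡ y × v ≡ x)

  IsStrongIASI : (Fin n → FinSet) → Set
  IsStrongIASI f = IsIASI f ×
    (∀ u v → Adj u v → ∣ edgeLabel f u v ∣ₛ ≡ ∣ f u ∣ₛ * ∣ f v ∣ₛ)

  IsIsoarithmeticIASI : (Fin n → FinSet) → Set
  IsIsoarithmeticIASI f = IsIASI f × ∃[ d ]
    ((∀ v → IsAPWith d (f v)) × (∀ u v → Adj u v → IsAPWith d (edgeLabel f u v)))

-- The sumset of two arithmetic progressions with the same common difference d,
-- of lengths k and m, is contained in the progression of length k + m - 1 with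
-- difference d starting at the sum of their first terms. Since every AP-set has
-- at least three elements, k + m - 1 < k m, so on any edge the label f⁺(uv) is
-- strictly smaller than |f(u)| |f(v)|.
module Submission where

open import Defs
open import Data.Nat using (ℕ; suc; _+_; _*_; _≤_; _<_; _≟_; s≤s; >-nonZero)
open import Data.Nat.Properties
open import Data.Fin using (Fin; zero; suc)
open import Data.Fin.Properties using (injective⇒≤)
open import Data.List using (List; length; lookup; map; upTo; deduplicate)
open import Data.List.Properties using (length-map; length-upTo)
open import Data.List.Membership.Propositional using (_∈_)
open import Data.List.Membership.Propositional.Properties
  using (∈-lookup; ∈-map⁺; ∈-map⁻; ∈-upTo⁺; ∈-upTo⁻; ∈-deduplicate⁺; ∈-deduplicate⁻;
         ∈-cartesianProductWith⁺; ∈-cartesianProductWith⁻)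
open import Data.List.Relation.Binary.Subset.Propositional using (_⊆_)
open import Data.List.Relation.Unary.All as All using ()
open import Data.List.Relation.Unary.Any using (index)
open import Data.List.Relation.Unary.Any.Properties using (lookup-index)
open import Data.List.Relation.Unary.Unique.Propositional using (Unique; _∷_)
open import Data.List.Relation.Unary.Unique.Propositional.Properties using (map⁺; upTo⁺)
open import Data.List.Relation.Unary.Unique.DecPropositional.Properties using (deduplicate-!)
open import Data.Product using (_×_; _,_; ∃-syntax)
open import Function.Bundles using (Equivalence)
open import Relation.Binary.PropositionalEquality
  using (_≡_; _≢_; refl; sym; trans; cong; cong₂; subst; module ≡-Reasoning)
open import Relation.Nullary using (contradiction)

private
  variable
    xs ys A B : List ℕ
    a b d k m : ℕ

Unique⇒lookup-injective : Unique xs → ∀ {i j} → lookup xs i ≡ lookup xs j → i ≡ j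
Unique⇒lookup-injective (_ ∷ _)       {zero}  {zero}  _  = refl
Unique⇒lookup-injective (x≢xs ∷ _)    {zero}  {suc j} eq = contradiction eq (All.lookup x≢xs (∈-lookup j))
Unique⇒lookup-injective (x≢xs ∷ _)    {suc i} {zero}  eq = contradiction (sym eq) (All.lookup x≢xs (∈-lookup i))
Unique⇒lookup-injective (_ ∷ unique)  {suc i} {suc j} eq = cong suc (Unique⇒lookup-injective unique eq)

Unique⇒length-mono-⊆ : Unique xs → xs ⊆ ys → length xs ≤ length ys
Unique⇒length-mono-⊆ {xs = xs} {ys = ys} unique xs⊆ys = injective⇒≤ position-injective
  where
  position : Fin (length xs) → Fin (length ys)
  position i = index (xs⊆ys (∈-lookup i))

  position-injective : ∀ {i j} → position i ≡ position j → i ≡ j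
  position-injective {i} {j} eq = Unique⇒lookup-injective unique (begin
    lookup xs i             ≡⟨ lookup-index (xs⊆ys (∈-lookup i)) ⟩
    lookup ys (position i)  ≡⟨ cong (lookup ys) eq ⟩
    lookup ys (position j)  ≡⟨ lookup-index (xs⊆ys (∈-lookup j)) ⟨
    lookup xs j             ∎)
    where open ≡-Reasoning

≈ₛ⇒⊆ : A ≈ₛ B → A ⊆ B
≈ₛ⇒⊆ A≈B {x} = Equivalence.to (A≈B x)

≈ₛ⇒⊇ : A ≈ₛ B → B ⊆ A
≈ₛ⇒⊇ A≈B {x} = Equivalence.from (A≈B x)

∣∣ₛ-≤-length : A ⊆ ys → ∣ A ∣ₛ ≤ length ys
∣∣ₛ-≤-length {A = A} A⊆ys =
  Unique⇒length-mono-⊆ (deduplicate-! _≟_ A) (λ x∈ → A⊆ys (∈-deduplicate⁻ _≟_ A x∈))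

length-≤-∣∣ₛ : Unique xs → xs ⊆ A → length xs ≤ ∣ A ∣ₛ
length-≤-∣∣ₛ unique xs⊆A = Unique⇒length-mono-⊆ unique (λ x∈ → ∈-deduplicate⁺ _≟_ (xs⊆A x∈))

⊕-mono-⊆ : A ⊆ xs → B ⊆ ys → A ⊕ B ⊆ xs ⊕ ys
⊕-mono-⊆ {A = A} {B = B} A⊆xs B⊆ys x∈
  with _ , _ , p∈ , q∈ , refl ← ∈-cartesianProductWith⁻ _+_ A B x∈
  = ∈-cartesianProductWith⁺ _+_ (A⊆xs p∈) (B⊆ys q∈)

ap : ℕ → ℕ → ℕ → List ℕ
ap a d k = map (λ i → a + i * d) (upTo k)

length-ap : length (ap a d k) ≡ k
length-ap {k = k} = trans (length-map _ (upTo k)) (length-upTo k)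

ap-unique : 1 ≤ d → Unique (ap a d k)
ap-unique {d = d} {a = a} {k = k} 1≤d = map⁺ step-injective (upTo⁺ k)
  where
  step-injective : ∀ {i j} → a + i * d ≡ a + j * d → i ≡ j
  step-injective {i} {j} eq = *-cancelʳ-≡ i j d {{>-nonZero 1≤d}} (+-cancelˡ-≡ a _ _ eq)

∈-ap⁺ : ∀ {i} → i < k → a + i * d ∈ ap a d k
∈-ap⁺ {a = a} {d = d} i<k = ∈-map⁺ (λ i → a + i * d) (∈-upTo⁺ i<k)

∈-ap⁻ : ∀ {x} → x ∈ ap a d k → ∃[ i ] (i < k × x ≡ a + i * d)
∈-ap⁻ {a = a} {d = d} x∈ with i , i∈ , refl ← ∈-map⁻ (λ i → a + i * d) x∈ = i , ∈-upTo⁻ i∈ , refl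

∣∣ₛ-ap : 1 ≤ d → A ≈ₛ ap a d k → ∣ A ∣ₛ ≡ k
∣∣ₛ-ap {A = A} 1≤d A≈ap = ≤-antisym
  (subst (∣ A ∣ₛ ≤_) length-ap (∣∣ₛ-≤-length (≈ₛ⇒⊆ A≈ap)))
  (subst (_≤ ∣ A ∣ₛ) length-ap (length-≤-∣∣ₛ (ap-unique 1≤d) (≈ₛ⇒⊇ A≈ap)))

ap-⊕-ap-⊆ : ap a d (suc k) ⊕ ap b d (suc m) ⊆ ap (a + b) d (suc (k + m))
ap-⊕-ap-⊆ {a = a} {d = d} {k = k} {b = b} {m = m} x∈
  with p , q , p∈ , q∈ , refl ← ∈-cartesianProductWith⁻ _+_ (ap a d (suc k)) (ap b d (suc m)) x∈
  with i , s≤s i≤k , refl ← ∈-ap⁻ p∈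
  with j , s≤s j≤m , refl ← ∈-ap⁻ q∈
  = subst (_∈ ap (a + b) d (suc (k + m))) (regroup a b i j d)
          (∈-ap⁺ (s≤s (+-mono-≤ i≤k j≤m)))
  where
  open import Data.Nat.Tactic.RingSolver using (solve-∀)
  regroup : ∀ a b i j d → a + b + (i + j) * d ≡ a + i * d + (b + j * d)
  regroup = solve-∀

suc-+<suc-*-suc : 1 ≤ k → 1 ≤ m → suc (k + m) < suc k * suc m
suc-+<suc-*-suc {k = k} {m = m} 1≤k 1≤m = s≤s (begin-strict
  k + m              ≡⟨ +-comm k m ⟩
  m + k              ≡⟨ +-identityʳ (m + k) ⟨
  m + k + 0          <⟨ +-monoʳ-< (m + k) (*-mono-< 1≤k 1≤m) ⟩
  m + k + k * m      ≡⟨ +-assoc m k (k * m) ⟩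
  m + (k + k * m)    ≡⟨ cong (m +_) (*-suc k m) ⟨
  m + k * suc m      ∎)
  where open ≤-Reasoning

IsAPWith⇒∣⊕∣ₛ<∣∣ₛ*∣∣ₛ : IsAPWith d A → IsAPWith d B → ∣ A ⊕ B ∣ₛ < ∣ A ∣ₛ * ∣ B ∣ₛ
IsAPWith⇒∣⊕∣ₛ<∣∣ₛ*∣∣ₛ {d = d} {A = A} {B = B}
  (1≤d , a , suc k , s≤s 2≤k , A≈ap) (_ , b , suc m , s≤s 2≤m , B≈ap) = begin-strict
    ∣ A ⊕ B ∣ₛ                           ≤⟨ ∣∣ₛ-≤-length A⊕B⊆ap ⟩
    length (ap (a + b) d (suc (k + m)))  ≡⟨ length-ap ⟩
    suc (k + m)                          <⟨ suc-+<suc-*-suc (<⇒≤ 2≤k) (<⇒≤ 2≤m) ⟩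
    suc k * suc m                        ≡⟨ cong₂ _*_ (∣∣ₛ-ap 1≤d A≈ap) (∣∣ₛ-ap 1≤d B≈ap) ⟨
    ∣ A ∣ₛ * ∣ B ∣ₛ                      ∎
  where
  open ≤-Reasoning
  A⊕B⊆ap : A ⊕ B ⊆ ap (a + b) d (suc (k + m))
  A⊕B⊆ap x∈ =
    ap-⊕-ap-⊆ {a = a} {k = k} {b = b} {m = m} (⊕-mono-⊆ (≈ₛ⇒⊆ A≈ap) (≈ₛ⇒⊆ B≈ap) x∈)

proposition2p9 : (G : Graph) (f : Fin (Graph.n G) → FinSet) →
    IsIsoarithmeticIASI G f →
    ∃[ u ] ∃[ v ] (Graph.Adj G u v × ∣ edgeLabel G f u v ∣ₛ ≢ ∣ f u ∣ₛ * ∣ f v ∣ₛ)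
proposition2p9 G f (_ , d , isAP , _) =
  let u , v , uv = Graph.hasEdge G
  in u , v , uv , <⇒≢ (IsAPWith⇒∣⊕∣ₛ<∣∣ₛ*∣∣ₛ (isAP u) (isAP v))
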